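{- During the execution of algorithm $\mathcal{D}^2\mathcal{I}$ on any input permutation, at every step we have $Top(D_2)<Top(I)$.
   Context: The $\mathfrak{D}^2\mathfrak{I}$ machine: stacks $D_1,D_2$ (elements in decreasing order from top to bottom, top largest) followed by stack $I$ (elements in increasing order from top to bottom, top smallest). Operations: $d_0$: push next input element into $D_1$; $d_1$: pop $D_1$, push into $D_2$; $d_2$: pop $D_2$, push into $I$; $d_3$: pop $I$ and append to the output. An operation is legal if it respects the stack order restrictions. $Top(X)$ is the top element of stack $X$, and $Input$ is the next element of the input; any statement about an empty stack is considered true. Algorithm $\mathcal{D}^2\mathcal{I}$ repeatedly executes the first applicable instruction among: (1) if $Top(I)$ is the next element to be output (the smallest element not yet output), perform $d_3$; (2) if all elements contained in $D_1$ and $D_2$ are the next elements to be output, move them to the output; (3) perform $d_1$, provided condition $(\beta)$ holds; (4) perform $d_0$, provided condition $(\gamma)$ holds; (5) perform $d_2$, provided condition $(\alpha)$ holds; (6) otherwise perform $d_3$. Here $(\alpha)$: $Top(D_2)<Top(I)$; $(\beta)$: $Top(D_2)<Top(D_1)$ and $Top(D_1)<Top(I)$; $(\gamma)$: $Top(D_1)<Input$, $Input<Top(I)$, and the sequence of input elements from $Input$ up to the first input element larger than $Top(D_2)$ is increasing. Operations are only performed when legal. -}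

module Defs where

open import Data.Nat using (ℕ; zero; suc; _+_; _<_; _<ᵇ_; _≡ᵇ_)
open import Data.Bool using (Bool; true; false; _∧_; _∨_; if_then_else_; not)
open import Data.List using (List; []; _∷_; _++_; length; map; upTo; applyUpTo)
open import Data.Bool.ListAction using (any; all)
open import Data.Maybe using (Maybe; just; nothing)
open import Data.Unit using (⊤)
open import Relation.Binary.PropositionalEquality using (_≡_)

-- Configuration of the D²I machine.
-- Stacks are lists whose head is the top.  D₁, D₂ must be decreasing from top
-- to bottom (top largest), I increasing from top to bottom (top smallest).
record State : Set where
  constructor ⟨_,_,_,_,_⟩
  field
    inp : List ℕ   -- remaining input, head = next input element
    d₁  : List ℕ
    d₂  : List ℕ
    i   : List ℕ
    out : List ℕ
open State public

-- "Top(X) < Top(Y)" where any statement about an empty stack is true.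
ltTopᵇ : List ℕ → List ℕ → Bool
ltTopᵇ []      _       = true
ltTopᵇ (_ ∷ _) []      = true
ltTopᵇ (x ∷ _) (y ∷ _) = x <ᵇ y

TopLt : List ℕ → List ℕ → Set
TopLt []      _       = ⊤
TopLt (_ ∷ _) []      = ⊤
TopLt (x ∷ _) (y ∷ _) = x < y

elemᵇ : ℕ → List ℕ → Bool
elemᵇ x = any (x ≡ᵇ_)

minimum? : List ℕ → Maybe ℕ
minimum? []       = nothing
minimum? (x ∷ xs) with minimum? xs
... | nothing = just x
... | just m  = just (if x <ᵇ m then x else m)

remaining : State → List ℕ
remaining s = inp s ++ d₁ s ++ d₂ s ++ i s

-- the next element to be output = smallest element not yet output
nextOut : State → Maybe ℕ
nextOut s = minimum? (remaining s)

increasingᵇ : List ℕ → Bool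
increasingᵇ []           = true
increasingᵇ (x ∷ [])     = true
increasingᵇ (x ∷ y ∷ xs) = (x <ᵇ y) ∧ increasingᵇ (y ∷ xs)

takeThrough : (ℕ → Bool) → List ℕ → List ℕ
takeThrough p []       = []
takeThrough p (x ∷ xs) = if p x then x ∷ [] else x ∷ takeThrough p xs

αᵇ : State → Bool
αᵇ s = ltTopᵇ (d₂ s) (i s)

βᵇ : State → Bool
βᵇ s = ltTopᵇ (d₂ s) (d₁ s) ∧ ltTopᵇ (d₁ s) (i s)

-- the input segment from Input up to the first input element larger than Top(D₂)
-- (if D₂ is empty every element is "larger", so the segment is just [Input])
segment : State → List ℕ
segment s with d₂ s
... | []    = takeThrough (λ _ → true) (inp s)
... | t ∷ _ = takeThrough (t <ᵇ_) (inp s)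

γᵇ : State → Bool
γᵇ s = ltTopᵇ (d₁ s) (inp s) ∧ ltTopᵇ (inp s) (i s) ∧ increasingᵇ (segment s)

rule1ᵇ : State → Bool
rule1ᵇ s with i s | nextOut s
... | x ∷ _ | just m = x ≡ᵇ m
... | _     | _      = false

-- Instruction (2): D₁ ∪ D₂ is nonempty and consists exactly of the next
-- |D₁|+|D₂| elements to be output, i.e. of m, m+1, …, m+k-1.
rule2ᵇ : State → Bool
rule2ᵇ s with d₁ s ++ d₂ s | nextOut s
... | []        | _      = false
... | ys@(_ ∷ _) | just m = all (λ j → elemᵇ (m + j) ys) (upTo (length ys))
... | _ ∷ _     | nothing = false

opD₀ opD₁ opD₂ opD₃ : State → Maybe State
opD₀ ⟨ x ∷ xs , a , b , c , o ⟩ = just ⟨ xs , x ∷ a , b , c , o ⟩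
opD₀ _ = nothing
opD₁ ⟨ xs , x ∷ a , b , c , o ⟩ = just ⟨ xs , a , x ∷ b , c , o ⟩
opD₁ _ = nothing
opD₂ ⟨ xs , a , x ∷ b , c , o ⟩ = just ⟨ xs , a , b , x ∷ c , o ⟩
opD₂ _ = nothing
opD₃ ⟨ xs , a , b , x ∷ c , o ⟩ = just ⟨ xs , a , b , c , o ++ (x ∷ []) ⟩
opD₃ _ = nothing

-- Instruction (2) as a single macro step: the elements of D₁ ∪ D₂, which are
-- m, …, m+k-1, are appended (in order) to the output; D₁ and D₂ become empty.
moveAll : State → Maybe State
moveAll s with nextOut s
... | just m  = just ⟨ inp s , [] , [] , i s ,
                       out s ++ applyUpTo (m +_) (length (d₁ s ++ d₂ s)) ⟩
... | nothing = nothing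

nonEmptyᵇ : List ℕ → Bool
nonEmptyᵇ []      = false
nonEmptyᵇ (_ ∷ _) = true

-- Legality: d₁ needs D₁ ≠ ∅ and Top(D₁) > Top(D₂) (implied by β);
-- d₀ needs input ≠ ∅ and Input > Top(D₁) (implied by γ);
-- d₂ needs D₂ ≠ ∅ and Top(D₂) < Top(I) (= α); d₃ needs I ≠ ∅.
-- `nothing` means no instruction applies (the algorithm stops).
step : State → Maybe State
step s =
  if rule1ᵇ s then opD₃ s
  else if rule2ᵇ s then moveAll s
  else if nonEmptyᵇ (d₁ s) ∧ βᵇ s then opD₁ s
  else if nonEmptyᵇ (inp s) ∧ γᵇ s then opD₀ s
  else if nonEmptyᵇ (d₂ s) ∧ αᵇ s then opD₂ s
  else opD₃ s

data Reach : State → State → Set where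
  here  : ∀ {s} → Reach s s
  there : ∀ {s s′ t} → step s ≡ just s′ → Reach s′ t → Reach s t

initial : List ℕ → State
initial xs = ⟨ xs , [] , [] , [] , [] ⟩

[1‥_] : ℕ → List ℕ
[1‥ n ] = applyUpTo suc n

module Submission where

-- Lemma 3 is proved as an invariant of the machine.  Call a configuration
-- well formed when D₂ is strictly decreasing (top largest), I is strictly
-- increasing (top smallest) and Top(D₂) < Top(I).  The initial configuration
-- (all stacks empty) is well formed, and every step of algorithm D²I keeps it
-- so, by inspecting which instruction fired:
--   * d₀ does not touch D₂ or I, and instruction (2) empties D₂;
--   * d₃ pops I, whose new top exceeds the old one because I is increasing;
--   * d₁ pushes Top(D₁) onto D₂ only under (β), which gives both
--     Top(D₂) < Top(D₁) (order in D₂) and Top(D₁) < Top(I);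
--   * d₂ moves Top(D₂) onto I only under (α), keeping I increasing, and the
--     new top of D₂ lies below the moved element since D₂ was decreasing.

open import Defs
open import Data.Nat using (ℕ; _<_; _>_)
open import Data.Nat.Properties using (<ᵇ⇒<; <-trans)
open import Data.List using (List; []; _∷_)
open import Data.List.Relation.Unary.Linked using (Linked; []; [-]; _∷_; head; tail)
open import Data.List.Relation.Binary.Permutation.Propositional using (_↭_)
open import Data.Bool using (true; false; _∧_; if_then_else_; T)
open import Data.Bool.Properties using (T-∧; T-≡)
open import Data.Unit using (tt)
open import Data.Product using (proj₁; proj₂)
open import Data.Maybe using (just; nothing)
open import Function.Bundles using (Equivalence)
open import Relation.Binary.PropositionalEquality using (_≡_; refl)

open Equivalence using (to; from)

ltTopᵇ-sound : ∀ xs ys → T (ltTopᵇ xs ys) → TopLt xs ys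
ltTopᵇ-sound []      _       _   = tt
ltTopᵇ-sound (_ ∷ _) []      _   = tt
ltTopᵇ-sound (x ∷ _) (y ∷ _) x<y = <ᵇ⇒< x y x<y

push-decreasing : ∀ {x a b} → Linked _>_ b → TopLt b (x ∷ a) → Linked _>_ (x ∷ b)
push-decreasing {b = []}    _   _   = [-]
push-decreasing {b = _ ∷ _} dec y<x = y<x ∷ dec

push-increasing : ∀ {x b c} → Linked _<_ c → TopLt (x ∷ b) c → Linked _<_ (x ∷ c)
push-increasing {c = []}    _   _   = [-]
push-increasing {c = _ ∷ _} inc x<z = x<z ∷ inc

below-popped : ∀ {b x c} → TopLt b (x ∷ c) → Linked _<_ (x ∷ c) → TopLt b c
below-popped {[]}                _   _   = tt
below-popped {_ ∷ _} {c = []}    _   _   = tt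
below-popped {_ ∷ _} {c = _ ∷ _} y<x inc = <-trans y<x (head inc)

rest-below-top : ∀ {y b c} → Linked _>_ (y ∷ b) → TopLt b (y ∷ c)
rest-below-top {b = []}    _         = tt
rest-below-top {b = _ ∷ _} (w<y ∷ _) = w<y

same-top : ∀ {x a b c} → TopLt (x ∷ a) c → TopLt (x ∷ b) c
same-top {c = []}    _   = tt
same-top {c = _ ∷ _} x<z = x<z

record Ordered (D I : List ℕ) : Set where
  field
    decreasing : Linked _>_ D
    increasing : Linked _<_ I
    top-below  : TopLt D I
open Ordered

WellFormed : State → Set
WellFormed s = Ordered (d₂ s) (i s)

-- How a step of the algorithm can have been taken: instructions (1) and (6)
-- perform d₃, (2) empties D₁ and D₂, and d₁, d₀, d₂ fire under their guards.
data StepCase (s s′ : State) : Set where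
  by-d₃      : opD₃ s ≡ just s′ → StepCase s s′
  by-moveAll : moveAll s ≡ just s′ → StepCase s s′
  by-d₁      : T (nonEmptyᵇ (d₁ s) ∧ βᵇ s) → opD₁ s ≡ just s′ → StepCase s s′
  by-d₀      : opD₀ s ≡ just s′ → StepCase s s′
  by-d₂      : T (nonEmptyᵇ (d₂ s) ∧ αᵇ s) → opD₂ s ≡ just s′ → StepCase s s′

step-cases : ∀ s {s′} → step s ≡ just s′ → StepCase s s′
step-cases s {s′} = first-applicable
  where
  -- `step s` unfolded, so that `with` can abstract the instruction tests.
  first-applicable : (if rule1ᵇ s then opD₃ s
                      else if rule2ᵇ s then moveAll s
                      else if nonEmptyᵇ (d₁ s) ∧ βᵇ s then opD₁ s
                      else if nonEmptyᵇ (inp s) ∧ γᵇ s then opD₀ s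
                      else if nonEmptyᵇ (d₂ s) ∧ αᵇ s then opD₂ s
                      else opD₃ s) ≡ just s′ → StepCase s s′
  first-applicable e with rule1ᵇ s | rule2ᵇ s | nonEmptyᵇ (d₁ s) ∧ βᵇ s in β-holds
                        | nonEmptyᵇ (inp s) ∧ γᵇ s | nonEmptyᵇ (d₂ s) ∧ αᵇ s in α-holds
  ... | true  | _     | _     | _     | _     = by-d₃ e
  ... | false | true  | _     | _     | _     = by-moveAll e
  ... | false | false | true  | _     | _     = by-d₁ (from T-≡ β-holds) e
  ... | false | false | false | true  | _     = by-d₀ e
  ... | false | false | false | false | true  = by-d₂ (from T-≡ α-holds) e
  ... | false | false | false | false | false = by-d₃ e

d₃-preserves : ∀ s {s′} → opD₃ s ≡ just s′ → WellFormed s → WellFormed s′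
d₃-preserves ⟨ _ , _ , _ , []    , _ ⟩ ()
d₃-preserves ⟨ _ , _ , _ , _ ∷ _ , _ ⟩ refl wf = record
  { decreasing = decreasing wf
  ; increasing = tail (increasing wf)
  ; top-below  = below-popped (top-below wf) (increasing wf)
  }

moveAll-preserves : ∀ s {s′} → moveAll s ≡ just s′ → WellFormed s → WellFormed s′
moveAll-preserves s e wf with nextOut s
moveAll-preserves s refl wf | just _ =
  record { decreasing = [] ; increasing = increasing wf ; top-below = tt }
moveAll-preserves s ()   wf | nothing

-- d₁ under (β) pushes Top(D₁), which lies between Top(D₂) and Top(I), onto D₂.
d₁-preserves : ∀ s {s′} → T (nonEmptyᵇ (d₁ s) ∧ βᵇ s) → opD₁ s ≡ just s′ →
               WellFormed s → WellFormed s′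
d₁-preserves ⟨ _ , []    , _ , _ , _ ⟩ _ ()
d₁-preserves ⟨ _ , x ∷ a , b , c , _ ⟩ β refl wf = record
  { decreasing = push-decreasing (decreasing wf) (ltTopᵇ-sound b (x ∷ a) d₂<d₁)
  ; increasing = increasing wf
  ; top-below  = same-top (ltTopᵇ-sound (x ∷ a) c d₁<i)
  }
  where
  d₂<d₁ : T (ltTopᵇ b (x ∷ a))
  d₂<d₁ = proj₁ (to T-∧ β)
  d₁<i : T (ltTopᵇ (x ∷ a) c)
  d₁<i = proj₂ (to T-∧ β)

d₀-preserves : ∀ s {s′} → opD₀ s ≡ just s′ → WellFormed s → WellFormed s′
d₀-preserves ⟨ []    , _ , _ , _ , _ ⟩ ()
d₀-preserves ⟨ _ ∷ _ , _ , _ , _ , _ ⟩ refl wf = wf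

d₂-preserves : ∀ s {s′} → T (nonEmptyᵇ (d₂ s) ∧ αᵇ s) → opD₂ s ≡ just s′ →
               WellFormed s → WellFormed s′
d₂-preserves ⟨ _ , _ , []    , _ , _ ⟩ _ ()
d₂-preserves ⟨ _ , _ , y ∷ b , c , _ ⟩ α refl wf = record
  { decreasing = tail (decreasing wf)
  ; increasing = push-increasing (increasing wf) (ltTopᵇ-sound (y ∷ b) c α)
  ; top-below  = rest-below-top (decreasing wf)
  }

step-preserves : ∀ s {s′} → step s ≡ just s′ → WellFormed s → WellFormed s′
step-preserves s e with step-cases s e
... | by-d₃ e′      = d₃-preserves s e′
... | by-moveAll e′ = moveAll-preserves s e′
... | by-d₁ β e′    = d₁-preserves s β e′
... | by-d₀ e′      = d₀-preserves s e′
... | by-d₂ α e′    = d₂-preserves s α e′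

reach-preserves : ∀ {s t} → Reach s t → WellFormed s → WellFormed t
reach-preserves here            wf = wf
reach-preserves (there {s} e r) wf = reach-preserves r (step-preserves s e wf)

initial-wellFormed : ∀ π → WellFormed (initial π)
initial-wellFormed _ = record { decreasing = [] ; increasing = [] ; top-below = tt }

lemma3 : (n : ℕ) (π : List ℕ) → π ↭ [1‥ n ] →
         ∀ s → Reach (initial π) s → TopLt (d₂ s) (i s)
lemma3 _ π _ _ run = top-below (reach-preserves run (initial-wellFormed π))
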